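{- Let $\mathbf{ILX}$ be a logic extending $\mathbf{IL}$, $\Gamma,\Delta$ $\mathbf{ILX}$-MCSs and $S$ a set of formulas with $\Gamma\prec_S\Delta$. Then: (1) $S\cup\Box S\subseteq\Delta$; (2) $\Diamond S\subseteq\Gamma$; (3) $S$ contains no formula of the form $\Diamond A$ or $\neg(A\rhd B)$.
   Context: Formulas: $\bot$, propositional variables, $\to$, $\Box$, binary $\rhd$; $\Diamond A:=\neg\Box\neg A$. $\mathbf{IL}$: classical tautologies, K, L: $\Box(\Box A\to A)\to\Box A$, J1: $\Box(A\to B)\to A\rhd B$, J2: $(A\rhd B)\wedge(B\rhd C)\to A\rhd C$, J3: $(A\rhd C)\wedge(B\rhd C)\to A\vee B\rhd C$, J4: $A\rhd B\to(\Diamond A\to\Diamond B)$, J5: $\Diamond A\rhd A$; rules modus ponens and necessitation. A logic extending $\mathbf{IL}$ is a superset closed under these rules; an $\mathbf{ILX}$-MCS is a maximal $\mathbf{ILX}$-consistent set. $\Gamma\prec_S\Delta$ iff for every formula $A$ and every finite $S'\subseteq S$, $\neg A\rhd\bigvee_{\sigma\in S'}\neg\sigma\in\Gamma$ implies $A,\Box A\in\Delta$ (empty disjunction is $\bot$). For a set $X$, $\Box X=\{\Box A:A\in X\}$ and $\Diamond X=\{\Diamond A:A\in X\}$. -}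

module Defs where

open import Data.Nat using (ℕ)
open import Data.Bool using (Bool; true; false; not; _∨_)
open import Data.List using (List; []; _∷_; map)
open import Data.List.Relation.Unary.All using (All)
open import Data.Product using (Σ; _×_)
open import Relation.Binary.PropositionalEquality using (_≡_)
open import Relation.Nullary using (¬_)

infixr 6 _⇒_
infix 7 _▷_

data Fm : Set where
  ⊥'  : Fm
  var : ℕ → Fm
  _⇒_ : Fm → Fm → Fm
  □   : Fm → Fm
  _▷_ : Fm → Fm → Fm

~_ : Fm → Fm
~ A = A ⇒ ⊥'

⊤' : Fm
⊤' = ~ ⊥'

_∧'_ : Fm → Fm → Fm
A ∧' B = ~ (A ⇒ ~ B)

_∨'_ : Fm → Fm → Fm
A ∨' B = (~ A) ⇒ B

◇ : Fm → Fm
◇ A = ~ □ (~ A)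

⋀ : List Fm → Fm
⋀ []       = ⊤'
⋀ (A ∷ As) = A ∧' ⋀ As

⋁ : List Fm → Fm
⋁ []       = ⊥'
⋁ (A ∷ As) = A ∨' ⋁ As

-- Classical tautologies: true under every Boolean valuation that treats
-- non-implicational, non-⊥ formulas (variables, □A, A▷B) as atoms.
eval : (Fm → Bool) → Fm → Bool
eval v ⊥'      = false
eval v (A ⇒ B) = not (eval v A) ∨ eval v B
eval v (var p) = v (var p)
eval v (□ A)   = v (□ A)
eval v (A ▷ B) = v (A ▷ B)

Tautology : Fm → Set
Tautology A = (v : Fm → Bool) → eval v A ≡ true

data IL⊢ : Fm → Set where
  taut : ∀ {A} → Tautology A → IL⊢ A
  axK  : ∀ {A B} → IL⊢ (□ (A ⇒ B) ⇒ (□ A ⇒ □ B))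
  axL  : ∀ {A} → IL⊢ (□ (□ A ⇒ A) ⇒ □ A)
  axJ1 : ∀ {A B} → IL⊢ (□ (A ⇒ B) ⇒ (A ▷ B))
  axJ2 : ∀ {A B C} → IL⊢ (((A ▷ B) ∧' (B ▷ C)) ⇒ (A ▷ C))
  axJ3 : ∀ {A B C} → IL⊢ (((A ▷ C) ∧' (B ▷ C)) ⇒ ((A ∨' B) ▷ C))
  axJ4 : ∀ {A B} → IL⊢ ((A ▷ B) ⇒ (◇ A ⇒ ◇ B))
  axJ5 : ∀ {A} → IL⊢ (◇ A ▷ A)
  mp   : ∀ {A B} → IL⊢ (A ⇒ B) → IL⊢ A → IL⊢ B
  nec  : ∀ {A} → IL⊢ A → IL⊢ (□ A)

FmSet : Set₁
FmSet = Fm → Set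

_⊆_ : FmSet → FmSet → Set
X ⊆ Y = ∀ A → X A → Y A

record ExtendsIL (X : FmSet) : Set where
  field
    includesIL : ∀ A → IL⊢ A → X A
    closedMP   : ∀ A B → X (A ⇒ B) → X A → X B
    closedNec  : ∀ A → X A → X (□ A)

Consistent : FmSet → FmSet → Set
Consistent X Γ = ¬ (Σ (List Fm) λ L → All Γ L × X (⋀ L ⇒ ⊥'))

record MCS (X : FmSet) (Γ : FmSet) : Set₁ where
  field
    consistent : Consistent X Γ
    maximal    : ∀ (Γ' : FmSet) → Γ ⊆ Γ' → Consistent X Γ' → Γ' ⊆ Γ

Prec : FmSet → FmSet → FmSet → Set
Prec S Γ Δ = ∀ (A : Fm) (S' : List Fm) → All S S' →
  Γ ((~ A) ▷ ⋁ (map ~_ S')) → Δ A × Δ (□ A)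

module Submission where

-- (1) Take S' = {σ} and A = σ: Γ contains ¬σ ▷ ¬σ by J1, so σ, □σ ∈ Δ.
-- (2) If ◇σ ∉ Γ then □¬σ ∈ Γ, hence ⊤ ▷ ¬σ ∈ Γ by J1, so ⊥ ∈ Δ.
-- (3) Whenever ⊢ □⊥ → ¬σ, the formula σ cannot lie in S: with C = ¬σ,
--     J5 puts ◇C ▷ C in Γ, so □¬C ∈ Δ; by Löb's axiom ⊢ □¬C → C, so ¬σ ∈ Δ,
--     contradicting σ ∈ Δ from (1).  Both ◇A and ¬(A ▷ B) are refuted by □⊥.

open import Defs
open import Data.Bool using (Bool; true; false; not; _∨_; _∧_; T)
open import Data.Bool.Properties using (T-∧; T-≡)
open import Data.Fin using (Fin; zero; suc)
open import Data.List using (List; []; _∷_; _++_)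
open import Data.List.Relation.Unary.All using (All; []; _∷_)
open import Data.List.Relation.Unary.All.Properties using (++⁺)
open import Data.Nat using (ℕ; zero; suc)
open import Data.Product using (Σ; _×_; _,_; proj₁; proj₂)
open import Data.Sum using (_⊎_; inj₁; inj₂)
open import Data.Vec using (Vec; []; _∷_; lookup; map)
open import Data.Vec.Properties using (lookup-map)
open import Function.Bundles using (Equivalence)
open import Relation.Binary.PropositionalEquality using (_≡_; refl; sym; trans; cong₂)
open import Relation.Nullary using (¬_)

open Equivalence using (to)

variable
  n : ℕ
  A B C D σ : Fm
  Γ Δ S : FmSet

infixr 6 _⇒ₛ_

data Schema (n : ℕ) : Set where
  ⊥ₛ   : Schema n
  ⟨_⟩  : Fin n → Schema n
  _⇒ₛ_ : Schema n → Schema n → Schema n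

_[_] : Schema n → Vec Fm n → Fm
⊥ₛ [ ρ ]       = ⊥'
⟨ i ⟩ [ ρ ]    = lookup ρ i
(φ ⇒ₛ ψ) [ ρ ] = φ [ ρ ] ⇒ ψ [ ρ ]

value : Schema n → Vec Bool n → Bool
value ⊥ₛ w       = false
value ⟨ i ⟩ w    = lookup w i
value (φ ⇒ₛ ψ) w = not (value φ w) ∨ value ψ w

eval-instance : ∀ v (φ : Schema n) ρ → eval v (φ [ ρ ]) ≡ value φ (map (eval v) ρ)
eval-instance v ⊥ₛ       ρ = refl
eval-instance v ⟨ i ⟩    ρ = sym (lookup-map i (eval v) ρ)
eval-instance v (φ ⇒ₛ ψ) ρ =
  cong₂ (λ a b → not a ∨ b) (eval-instance v φ ρ) (eval-instance v ψ ρ)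

every : ∀ n → (Vec Bool n → Bool) → Bool
every zero    f = f []
every (suc n) f = every n (λ w → f (true ∷ w)) ∧ every n (λ w → f (false ∷ w))

every-sound : ∀ n f → T (every n f) → ∀ w → T (f w)
every-sound zero    f ok []          = ok
every-sound (suc n) f ok (true ∷ w)  =
  every-sound n (λ w → f (true ∷ w)) (proj₁ (to T-∧ ok)) w
every-sound (suc n) f ok (false ∷ w) =
  every-sound n (λ w → f (false ∷ w)) (proj₂ (to T-∧ ok)) w

Valid : Schema n → Set
Valid {n} φ = T (every n (value φ))

valid-instance : (φ : Schema n) → Valid φ → ∀ ρ → Tautology (φ [ ρ ])
valid-instance {n} φ ok ρ v =
  trans (eval-instance v φ ρ) (to T-≡ (every-sound n (value φ) ok (map (eval v) ρ)))

~ₛ_ : Schema n → Schema n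
~ₛ φ = φ ⇒ₛ ⊥ₛ

⊤ₛ : Schema n
⊤ₛ = ~ₛ ⊥ₛ

_∧ₛ_ _∨ₛ_ : Schema n → Schema n → Schema n
φ ∧ₛ ψ = ~ₛ (φ ⇒ₛ ~ₛ ψ)
φ ∨ₛ ψ = (~ₛ φ) ⇒ₛ ψ

infixr 7 _∧ₛ_ _∨ₛ_
infix 8 ~ₛ_

p : Schema (suc n)
p = ⟨ zero ⟩

q : Schema (suc (suc n))
q = ⟨ suc zero ⟩

r : Schema (suc (suc (suc n)))
r = ⟨ suc (suc zero) ⟩

s : Schema (suc (suc (suc (suc n))))
s = ⟨ suc (suc (suc zero)) ⟩

t : Schema (suc (suc (suc (suc (suc n)))))
t = ⟨ suc (suc (suc (suc zero))) ⟩

module InLogic (X : FmSet) (E : ExtendsIL X) where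
  open ExtendsIL E

  theorem : IL⊢ A → X A
  theorem = includesIL _

  modus-ponens : X (A ⇒ B) → X A → X B
  modus-ponens = closedMP _ _

  -- Instances of valid schemas are theorems; validity is checked by evaluation.
  tautology : (φ : Schema n) {ok : Valid φ} (ρ : Vec Fm n) → X (φ [ ρ ])
  tautology φ {ok} ρ = theorem (taut (valid-instance φ ok ρ))

  infixr 4 _⨾_

  _⨾_ : X (A ⇒ B) → X (B ⇒ C) → X (A ⇒ C)
  _⨾_ {A = A} {B = B} {C = C} ab bc =
    modus-ponens (modus-ponens (tautology ((p ⇒ₛ q) ⇒ₛ (q ⇒ₛ r) ⇒ₛ p ⇒ₛ r) (A ∷ B ∷ C ∷ [])) ab) bc

  ~~-intro : X (A ⇒ ~ ~ A)
  ~~-intro {A = A} = tautology (p ⇒ₛ ~ₛ ~ₛ p) (A ∷ [])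

  ~~-elim : X (~ ~ A ⇒ A)
  ~~-elim {A = A} = tautology (~ₛ ~ₛ p ⇒ₛ p) (A ∷ [])

  ∨⊥-intro : X (A ⇒ A ∨' ⊥')
  ∨⊥-intro {A = A} = tautology (p ⇒ₛ p ∨ₛ ⊥ₛ) (A ∷ [])

  ∨⊥-elim : X (A ∨' ⊥' ⇒ A)
  ∨⊥-elim {A = A} = tautology (p ∨ₛ ⊥ₛ ⇒ₛ p) (A ∷ [])

  ⋀-++ : ∀ L M → X (⋀ (L ++ M) ⇒ ⋀ L ∧' ⋀ M)
  ⋀-++ []      M = tautology (p ⇒ₛ ⊤ₛ ∧ₛ p) (⋀ M ∷ [])
  ⋀-++ (C ∷ L) M = modus-ponens
    (tautology ((p ⇒ₛ q ∧ₛ r) ⇒ₛ (s ∧ₛ p ⇒ₛ (s ∧ₛ q) ∧ₛ r))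
               (⋀ (L ++ M) ∷ ⋀ L ∷ ⋀ M ∷ C ∷ []))
    (⋀-++ L M)

  -- Γ ⊢ C: C follows in X from finitely many members of Γ.
  -- Note that Consistent X Γ is exactly ¬ (Γ ⊢ ⊥').
  infix 3 _⊢_

  _⊢_ : FmSet → Fm → Set
  Γ ⊢ C = Σ (List Fm) λ L → All Γ L × X (⋀ L ⇒ C)

  derive-by : X (A ⇒ B) → Γ ⊢ A → Γ ⊢ B
  derive-by ab (L , L⊆Γ , h) = L , L⊆Γ , (h ⨾ ab)

  derive-theorem : X A → Γ ⊢ A
  derive-theorem {A = A} ⊢A = [] , [] , modus-ponens (tautology (p ⇒ₛ ⊤ₛ ⇒ₛ p) (A ∷ [])) ⊢A

  derive-member : Γ A → Γ ⊢ A
  derive-member {A = A} A∈Γ = A ∷ [] , A∈Γ ∷ [] , tautology (p ∧ₛ ⊤ₛ ⇒ₛ p) (A ∷ [])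

  derive-mp : Γ ⊢ A ⇒ B → Γ ⊢ A → Γ ⊢ B
  derive-mp {A = A} {B = B} (L , L⊆Γ , hL) (M , M⊆Γ , hM) =
    L ++ M , ++⁺ L⊆Γ M⊆Γ ,
    modus-ponens (modus-ponens (modus-ponens
      (tautology ((p ⇒ₛ q ∧ₛ r) ⇒ₛ (q ⇒ₛ s ⇒ₛ t) ⇒ₛ (r ⇒ₛ s) ⇒ₛ p ⇒ₛ t)
                 (⋀ (L ++ M) ∷ ⋀ L ∷ ⋀ M ∷ A ∷ B ∷ []))
      (⋀-++ L M)) hL) hM

  _∪⟨_⟩ : FmSet → Fm → FmSet
  (Γ ∪⟨ D ⟩) C = Γ C ⊎ C ≡ D

  curry-head : ∀ B L → X (⋀ (B ∷ L) ⇒ C) → X (⋀ L ⇒ B ⇒ C)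
  curry-head {C = C} B L =
    modus-ponens (tautology ((p ∧ₛ q ⇒ₛ r) ⇒ₛ q ⇒ₛ p ⇒ₛ r) (B ∷ ⋀ L ∷ C ∷ []))

  discharge : ∀ L → All (Γ ∪⟨ D ⟩) L → X (⋀ L ⇒ C) → Γ ⊢ D ⇒ C
  discharge {D = D} {C = C} [] [] h =
    derive-theorem (modus-ponens (tautology ((⊤ₛ ⇒ₛ p) ⇒ₛ q ⇒ₛ p) (C ∷ D ∷ [])) h)
  discharge {D = D} {C = C} (B ∷ L) (inj₁ B∈Γ ∷ L⊆) h =
    derive-mp (derive-by (tautology ((p ⇒ₛ q ⇒ₛ r) ⇒ₛ q ⇒ₛ p ⇒ₛ r) (D ∷ B ∷ C ∷ []))
                         (discharge L L⊆ (curry-head B L h)))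
              (derive-member B∈Γ)
  discharge {D = D} {C = C} (.D ∷ L) (inj₂ refl ∷ L⊆) h =
    derive-by (tautology ((p ⇒ₛ p ⇒ₛ q) ⇒ₛ p ⇒ₛ q) (D ∷ C ∷ []))
              (discharge L L⊆ (curry-head D L h))

  -- A formula whose negation is not derivable from an MCS belongs to it,
  -- since adding it keeps the set consistent.
  mcs-insert : MCS X Γ → ¬ (Γ ⊢ ~ D) → Γ D
  mcs-insert {Γ = Γ} {D = D} mΓ ⊬~D =
    MCS.maximal mΓ (Γ ∪⟨ D ⟩) (λ _ → inj₁) consistent D (inj₂ refl)
    where
    consistent : Consistent X (Γ ∪⟨ D ⟩)
    consistent (L , L⊆ , h) = ⊬~D (discharge L L⊆ h)

  mcs-closed : MCS X Γ → Γ ⊢ A → Γ A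
  mcs-closed mΓ ⊢A = mcs-insert mΓ λ ⊢~A → MCS.consistent mΓ (derive-mp ⊢~A ⊢A)

  mcs-theorem : MCS X Γ → X A → Γ A
  mcs-theorem mΓ ⊢A = mcs-closed mΓ (derive-theorem ⊢A)

  □-mono : X (A ⇒ B) → X (□ A ⇒ □ B)
  □-mono ab = modus-ponens (theorem axK) (closedNec _ ab)

  ▷-of-implication : X (A ⇒ B) → X (A ▷ B)
  ▷-of-implication ab = modus-ponens (theorem axJ1) (closedNec _ ab)

  □⊥-box : X (□ ⊥' ⇒ □ A)
  □⊥-box {A = A} = □-mono (tautology (⊥ₛ ⇒ₛ p) (A ∷ []))

  -- Löb: if B follows from □⊥, then □¬B implies B
  -- (¬B → ¬□⊥ boxes to □¬B → □(□⊥ → ⊥), and L yields □⊥).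
  □¬-implies : X (□ ⊥' ⇒ B) → X (□ (~ B) ⇒ B)
  □¬-implies {B = B} h = □-mono contraposed ⨾ theorem axL ⨾ h
    where
    contraposed : X (~ B ⇒ ~ □ ⊥')
    contraposed = modus-ponens (tautology ((p ⇒ₛ q) ⇒ₛ ~ₛ q ⇒ₛ ~ₛ p) (□ ⊥' ∷ B ∷ [])) h

  -- The instance of Γ ≺_S Δ for a one-element subset {σ} ⊆ S,
  -- where ⋁{¬σ} is ¬σ ∨ ⊥.
  prec-single : Prec S Γ Δ → S σ → ∀ A → Γ (~ A ▷ ((~ σ) ∨' ⊥')) → Δ A × Δ (□ A)
  prec-single {σ = σ} pr σ∈S A = pr A (σ ∷ []) (σ∈S ∷ [])

  -- Part (1): σ, □σ ∈ Δ, since ¬σ ▷ (¬σ ∨ ⊥) is a theorem.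
  prec-in-Δ : MCS X Γ → Prec S Γ Δ → S σ → Δ σ × Δ (□ σ)
  prec-in-Δ {Γ = Γ} {Δ = Δ} {σ = σ} mΓ pr σ∈S =
    prec-single {Γ = Γ} {Δ = Δ} pr σ∈S σ (mcs-theorem mΓ (▷-of-implication ∨⊥-intro))

  -- Part (2): ◇σ ∈ Γ; otherwise □¬σ, hence ⊤ ▷ (¬σ ∨ ⊥), lies in Γ and ⊥ ∈ Δ.
  prec-◇ : MCS X Γ → MCS X Δ → Prec S Γ Δ → S σ → Γ (◇ σ)
  prec-◇ {Γ = Γ} {Δ = Δ} {σ = σ} mΓ mΔ pr σ∈S = mcs-insert mΓ λ ⊢¬◇σ →
    MCS.consistent mΔ (derive-member (proj₁
      (prec-single {Γ = Γ} {Δ = Δ} pr σ∈S ⊥' (mcs-closed mΓ (derive-by ¬◇-interprets ⊢¬◇σ)))))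
    where
    ¬◇-interprets : X (~ ◇ σ ⇒ (⊤' ▷ ((~ σ) ∨' ⊥')))
    ¬◇-interprets =
      ~~-elim ⨾ □-mono (tautology (~ₛ p ⇒ₛ ⊤ₛ ⇒ₛ (~ₛ p) ∨ₛ ⊥ₛ) (σ ∷ [])) ⨾ theorem axJ1

  -- J5 gives
  -- ◇¬σ ▷ ¬σ ∈ Γ, so □¬¬σ ∈ Δ; Löb turns this into ¬σ ∈ Δ, against σ ∈ Δ.
  -- (Here ¬σ is written ¬σ ∨ ⊥, the disjunction ⋁{¬σ} of ≺_S.)
  prec-not-refuted-by-□⊥ : MCS X Γ → MCS X Δ → Prec S Γ Δ → X (□ ⊥' ⇒ ~ σ) → ¬ S σ
  prec-not-refuted-by-□⊥ {Γ = Γ} {Δ = Δ} {σ = σ} mΓ mΔ pr h σ∈S =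
    MCS.consistent mΔ (derive-mp (derive-by ∨⊥-elim Δ⊢¬σ) (derive-member σ∈Δ))
    where
    ¬σ : Fm
    ¬σ = (~ σ) ∨' ⊥'
    □¬¬σ∈Δ : Δ (□ (~ ¬σ))
    □¬¬σ∈Δ = proj₁ (prec-single {Γ = Γ} {Δ = Δ} pr σ∈S (□ (~ ¬σ))
                                 (mcs-theorem mΓ (theorem (axJ5 {¬σ}))))
    σ∈Δ : Δ σ
    σ∈Δ = proj₁ (prec-in-Δ {Δ = Δ} mΓ pr σ∈S)
    Δ⊢¬σ : Δ ⊢ ¬σ
    Δ⊢¬σ = derive-by (□¬-implies (h ⨾ ∨⊥-intro)) (derive-member □¬¬σ∈Δ)

  □⊥-refutes-◇ : X (□ ⊥' ⇒ ~ ◇ A)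
  □⊥-refutes-◇ = □⊥-box ⨾ ~~-intro

  □⊥-refutes-¬▷ : X (□ ⊥' ⇒ ~ ~ (A ▷ B))
  □⊥-refutes-¬▷ = □⊥-box ⨾ theorem axJ1 ⨾ ~~-intro

lemma3p7 : (X : FmSet) → ExtendsIL X → (Γ Δ S : FmSet) →
    MCS X Γ → MCS X Δ → Prec S Γ Δ →
    ((∀ A → S A → Δ A) × (∀ A → S A → Δ (□ A)))
    × (∀ A → S A → Γ (◇ A))
    × ((∀ A → ¬ S (◇ A)) × (∀ A B → ¬ S (~ (A ▷ B))))
lemma3p7 X E Γ Δ S mΓ mΔ pr =
  ((λ A σ∈S → proj₁ (prec-in-Δ {Δ = Δ} mΓ pr σ∈S)) ,
   (λ A σ∈S → proj₂ (prec-in-Δ {Δ = Δ} mΓ pr σ∈S))) ,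
  (λ A → prec-◇ mΓ mΔ pr) ,
  ((λ A → prec-not-refuted-by-□⊥ mΓ mΔ pr □⊥-refutes-◇) ,
   (λ A B → prec-not-refuted-by-□⊥ mΓ mΔ pr □⊥-refutes-¬▷))
  where open InLogic X E
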